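{- Let $G$ be an almost well-covered $\{C_3,C_4,C_5,C_7\}$-free graph. Then every vertex $x\in V(G_0)$ satisfies $d_{G_0}(x)\leq 2$.
   Context: All graphs are finite and simple. $C_n$ is the cycle on $n$ vertices; a graph is $\mathcal{F}$-free if it has no induced subgraph isomorphic to a member of $\mathcal{F}$. For a graph $G$, $\alpha(G)$ is the maximum size of an independent set and $i(G)$ is the minimum size of an inclusion-maximal independent set; $G$ is almost well-covered if $\alpha(G)-i(G)=1$. Types: let $U$ be the set of vertices whose connected component in $G$ is a complete graph. In $G-U$, a leaf is a vertex of degree $1$ and an internal vertex is a vertex that is not a leaf. An internal vertex of $G-U$ adjacent to exactly $k$ leaves is of type $k$; every vertex of $U$ is of type $0$. $G_0$ denotes the subgraph of $G$ induced by all vertices of type $0$, and $d_{G_0}(x)$ is the degree of $x$ in $G_0$. -}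

module Defs where

open import Data.Nat using (ℕ; zero; suc; _≤_)
open import Data.Bool using (Bool; true; false)
open import Data.Fin using (Fin; toℕ)
open import Data.Fin.Subset using (Subset; _∈_; _∉_; ∣_∣)
open import Data.List using (List; length)
open import Data.List.Relation.Unary.Unique.Propositional using (Unique)
import Data.List.Membership.Propositional as LM
open import Data.Product using (Σ; ∃; _×_; _,_)
open import Data.Sum using (_⊎_)
open import Relation.Nullary using (¬_)
open import Relation.Binary.PropositionalEquality using (_≡_; _≢_)
open import Function.Bundles using (_⇔_)
open import Function.Definitions using (Injective)

record Graph : Set where
  field
    n      : ℕ
    adj    : Fin n → Fin n → Bool
    sym    : ∀ u v → adj u v ≡ adj v u
    irrefl : ∀ v → adj v v ≡ false

module _ (G : Graph) where
  open Graph G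

  Adj : Fin n → Fin n → Set
  Adj u v = adj u v ≡ true

  HasExactly : (Fin n → Set) → ℕ → Set
  HasExactly P k = Σ (List (Fin n)) λ xs →
    Unique xs × (∀ v → (LM._∈_ v xs ⇔ P v)) × length xs ≡ k

  Independent : Subset n → Set
  Independent S = ∀ u v → u ∈ S → v ∈ S → adj u v ≡ false

  MaximalIndependent : Subset n → Set
  MaximalIndependent S = Independent S × (∀ v → v ∉ S → ∃ λ u → u ∈ S × Adj u v)

  IsAlpha : ℕ → Set
  IsAlpha a = (∃ λ S → Independent S × ∣ S ∣ ≡ a)
            × (∀ T → Independent T → ∣ T ∣ ≤ a)

  IsIndepDomination : ℕ → Set
  IsIndepDomination b = (∃ λ S → MaximalIndependent S × ∣ S ∣ ≡ b)
                      × (∀ T → MaximalIndependent T → b ≤ ∣ T ∣)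

  AlmostWellCovered : Set
  AlmostWellCovered = ∃ λ a → ∃ λ b → IsAlpha a × IsIndepDomination b × a ≡ suc b

  -- cyclic adjacency on Fin k (meaningful for k ≥ 3)
  CycAdj : (k : ℕ) → Fin k → Fin k → Set
  CycAdj k i j = suc (toℕ i) ≡ toℕ j ⊎ suc (toℕ j) ≡ toℕ i
               ⊎ (toℕ i ≡ 0 × suc (toℕ j) ≡ k) ⊎ (toℕ j ≡ 0 × suc (toℕ i) ≡ k)

  HasInducedCycle : ℕ → Set
  HasInducedCycle k = Σ (Fin k → Fin n) λ f →
    Injective _≡_ _≡_ f × (∀ i j → (Adj (f i) (f j) ⇔ CycAdj k i j))

  data Reach (v : Fin n) : Fin n → Set where
    here : Reach v v
    step : ∀ {u w} → Reach v u → Adj u w → Reach v w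

  InU : Fin n → Set
  InU v = ∀ u w → Reach v u → Reach v w → u ≢ w → Adj u w

  Leaf : Fin n → Set
  Leaf v = ¬ InU v × HasExactly (λ u → ¬ InU u × Adj v u) 1

  Internal : Fin n → Set
  Internal v = ¬ InU v × ¬ Leaf v

  Type0 : Fin n → Set
  Type0 v = InU v ⊎ (Internal v × HasExactly (λ u → Adj v u × Leaf u) 0)

  DegG0AtMost : Fin n → ℕ → Set
  DegG0AtMost x d = ∀ (xs : List (Fin n)) → Unique xs →
    (∀ u → LM._∈_ u xs → Adj x u × Type0 u) → length xs ≤ d

module Submission where

-- Let Y be a set of type-0 neighbours of x; we show |Y| ≤ 2. Call w beyond Y if y ∼ z ∼ w for
-- some y ∈ Y, z ≠ x and w ≠ y. As G has no induced C₃, C₄, C₅, C₇, it has no closed walk of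
-- length 3, 5 or 7 and no 4-cycle, so x together with all vertices beyond Y is independent;
-- extend it to a maximal independent set S. A neighbour s ≠ x of some y ∈ Y is not in S: if the
-- component of y is complete then s ∼ x, and otherwise s is not a leaf (y has type 0), so s has
-- a neighbour beyond Y. Hence (S − x) ∪ Y is independent, and almost well-coveredness gives
-- |S| − 1 + |Y| ≤ α(G) = i(G) + 1 ≤ |S| + 1.

open import Defs
open import Data.Nat using (ℕ; zero; suc; _+_; _∸_; _≤_; _<_; s≤s; z≤n; _≤?_)
open import Data.Nat.Properties
  using ( ≤-trans; <-cmp; <-irrefl; 1+n≰n; ≰⇒>; <⇒≤; ≤∧≢⇒<; m≤m+n; m≤n+m; m∸n+n≡m
        ; +-suc; +-comm; +-identityʳ; +-assoc; +-mono-≤; +-monoʳ-≤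
        ; +-cancelˡ-≤; +-cancelʳ-≤; +-cancelʳ-<; module ≤-Reasoning )
open import Data.Bool using (true; false)
import Data.Bool as Bool
import Data.Nat as ℕ
open import Data.Bool.Properties using (¬-not)
open import Data.Fin using (Fin; toℕ)
open import Data.Fin.Properties using (any?; toℕ-injective; toℕ<n) renaming (_≟_ to _≟ᶠ_)
open import Data.Fin.Subset using (Subset; _∈_; _∉_; _⊆_; ∣_∣; _∪_; _─_; _-_; ⁅_⁆; ⊥)
open import Data.Fin.Subset.Properties
  using (_∈?_; x∈p∪q⁺; x∈p∪q⁻; p⊆p∪q; x∈⁅x⁆; x∈⁅y⁆⇒x≡y; ∉⊥; ∣⁅x⁆∣≡1; ∣⊥∣≡0; p─⊥≡p; p─q⊆p)
open import Data.List using (List; []; _∷_; length; foldr; allFin)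
open import Data.List.Relation.Unary.All using ([]; _∷_)
open import Data.List.Relation.Unary.AllPairs using ([]; _∷_)
open import Data.List.Relation.Unary.Any as Any using ()
open import Data.List.Relation.Unary.Unique.Propositional using (Unique)
import Data.List.Membership.Propositional as List
open import Data.List.Membership.Propositional.Properties using (∈-allFin)
open import Data.List.Relation.Unary.All.Properties using (All¬⇒¬Any)
open import Data.Product using (∃; _×_; _,_; proj₁; proj₂)
open import Data.Sum using (_⊎_; inj₁; inj₂; [_,_]′)
open import Data.Vec using (_∷_; []; tabulate; here; there)
open import Data.Vec.Properties using (lookup∘tabulate; []=⇒lookup; lookup⇒[]=)
import Data.Empty as Empty
open import Function using (_∘_; id; flip)
open import Function.Bundles using (_⇔_; mk⇔; Equivalence)
open import Relation.Nullary using (¬_; yes; no; does; contradiction)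
open import Relation.Nullary.Decidable using (_×-dec_; _⊎-dec_; ¬?; dec-true; decidable-stable)
open import Relation.Unary using (Decidable)
open import Relation.Binary.Definitions using (tri<; tri≈; tri>) renaming (Decidable to Decidable₂)
open import Relation.Binary.PropositionalEquality
  using (_≡_; _≢_; refl; sym; trans; cong; cong₂; subst; subst₂; ≢-sym; module ≡-Reasoning)

private
  variable
    m : ℕ

toSubset : {P : Fin m → Set} → Decidable P → Subset m
toSubset P? = tabulate (λ v → does (P? v))

∈-toSubset⁺ : {P : Fin m → Set} (P? : Decidable P) {v : Fin m} → P v → v ∈ toSubset P?
∈-toSubset⁺ P? {v} p = lookup⇒[]= v _ (trans (lookup∘tabulate _ v) (dec-true (P? v) p))

∈-toSubset⁻ : {P : Fin m → Set} (P? : Decidable P) {v : Fin m} → v ∈ toSubset P? → P v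
∈-toSubset⁻ P? {v} v∈ with P? v | trans (sym (lookup∘tabulate (λ u → does (P? u)) v)) ([]=⇒lookup v∈)
... | yes p | _ = p

fromList : List (Fin m) → Subset m
fromList = foldr (λ v p → ⁅ v ⁆ ∪ p) ⊥

∈-fromList⁻ : {v : Fin m} (vs : List (Fin m)) → v ∈ fromList vs → v List.∈ vs
∈-fromList⁻ []       v∈ = contradiction v∈ ∉⊥
∈-fromList⁻ (u ∷ us) v∈ with x∈p∪q⁻ ⁅ u ⁆ (fromList us) v∈
... | inj₁ v∈⁅u⁆ = Any.here (x∈⁅y⁆⇒x≡y u v∈⁅u⁆)
... | inj₂ v∈us  = Any.there (∈-fromList⁻ us v∈us)

x∈p─q⇒x∉q : {x : Fin m} (p q : Subset m) → x ∈ p ─ q → x ∉ q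
x∈p─q⇒x∉q (true ∷ p) (false ∷ q) here        = λ ()
x∈p─q⇒x∉q (_ ∷ p)    (_ ∷ q)     (there x∈p─q) (there x∈q) = x∈p─q⇒x∉q p q x∈p─q x∈q

x∈p-y⇒x≢y : {x y : Fin m} {p : Subset m} → x ∈ p - y → x ≢ y
x∈p-y⇒x≢y {y = y} {p} x∈p-y refl = x∈p─q⇒x∉q p ⁅ y ⁆ x∈p-y (x∈⁅x⁆ y)

suc∣p-x∣≡∣p∣ : {x : Fin m} (p : Subset m) → x ∈ p → suc ∣ p - x ∣ ≡ ∣ p ∣
suc∣p-x∣≡∣p∣ (true ∷ p)  here        = cong (suc ∘ ∣_∣) (p─⊥≡p p)
suc∣p-x∣≡∣p∣ (true ∷ p)  (there x∈p) = cong suc (suc∣p-x∣≡∣p∣ p x∈p)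
suc∣p-x∣≡∣p∣ (false ∷ p) (there x∈p) = suc∣p-x∣≡∣p∣ p x∈p

disjoint-tail : ∀ {s t} {p q : Subset m} → (∀ {v} → v ∈ s ∷ p → v ∉ t ∷ q) → ∀ {v} → v ∈ p → v ∉ q
disjoint-tail disjoint v∈p v∈q = disjoint (there v∈p) (there v∈q)

∣p∪q∣≡∣p∣+∣q∣ : (p q : Subset m) → (∀ {v} → v ∈ p → v ∉ q) → ∣ p ∪ q ∣ ≡ ∣ p ∣ + ∣ q ∣
∣p∪q∣≡∣p∣+∣q∣ []          []          _     = refl
∣p∪q∣≡∣p∣+∣q∣ (true ∷ p)  (true ∷ q)  p∩q≡∅ = contradiction here (p∩q≡∅ here)
∣p∪q∣≡∣p∣+∣q∣ (true ∷ p)  (false ∷ q) p∩q≡∅ = cong suc (∣p∪q∣≡∣p∣+∣q∣ p q (disjoint-tail p∩q≡∅))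
∣p∪q∣≡∣p∣+∣q∣ (false ∷ p) (true ∷ q)  p∩q≡∅ =
  trans (cong suc (∣p∪q∣≡∣p∣+∣q∣ p q (disjoint-tail p∩q≡∅))) (sym (+-suc ∣ p ∣ ∣ q ∣))
∣p∪q∣≡∣p∣+∣q∣ (false ∷ p) (false ∷ q) p∩q≡∅ = ∣p∪q∣≡∣p∣+∣q∣ p q (disjoint-tail p∩q≡∅)

∣fromList∣≡length : (vs : List (Fin m)) → Unique vs → ∣ fromList vs ∣ ≡ length vs
∣fromList∣≡length {m} []       []             = ∣⊥∣≡0 m
∣fromList∣≡length (v ∷ vs) (v∉vs ∷ unique) = begin
  ∣ ⁅ v ⁆ ∪ fromList vs ∣       ≡⟨ ∣p∪q∣≡∣p∣+∣q∣ ⁅ v ⁆ (fromList vs) disjoint ⟩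
  ∣ ⁅ v ⁆ ∣ + ∣ fromList vs ∣   ≡⟨ cong₂ _+_ (∣⁅x⁆∣≡1 v) (∣fromList∣≡length vs unique) ⟩
  suc (length vs)               ∎
  where
  open ≡-Reasoning
  disjoint : ∀ {u} → u ∈ ⁅ v ⁆ → u ∉ fromList vs
  disjoint u∈⁅v⁆ u∈vs with x∈⁅y⁆⇒x≡y v u∈⁅v⁆
  ... | refl = All¬⇒¬Any v∉vs (∈-fromList⁻ vs u∈vs)

module _ (G : Graph) where
  open Graph G using (n; adj) renaming (sym to adj-sym; irrefl to adj-irrefl)

  infix 4 _~_ _≁_

  _~_ : Fin n → Fin n → Set
  _~_ = Adj G

  ~-sym : ∀ {u v} → u ~ v → v ~ u
  ~-sym {u} {v} u~v = trans (adj-sym v u) u~v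

  ~-irrefl : ∀ {v} → ¬ v ~ v
  ~-irrefl {v} v~v with trans (sym (adj-irrefl v)) v~v
  ... | ()

  ~⇒≢ : ∀ {u v} → u ~ v → u ≢ v
  ~⇒≢ u~v refl = ~-irrefl u~v

  _~?_ : Decidable₂ _~_
  u ~? v = adj u v Bool.≟ true

  _≁_ : Fin n → Fin n → Set
  u ≁ v = u ≢ v × ¬ u ~ v

  ≁-sym : ∀ {u v} → u ≁ v → v ≁ u
  ≁-sym (u≢v , ¬u~v) = ≢-sym u≢v , ¬u~v ∘ ~-sym

  record ClosedWalk (k : ℕ) (w : ℕ → Fin n) : Set where
    field
      edge   : ∀ i → w i ~ w (suc i)
      period : ∀ i → w (k + i) ≡ w i

  Chordless : ℕ → (ℕ → Fin n) → Set
  Chordless k w = ∀ r d → 2 ≤ d → d + d ≤ k → w r ≁ w (d + r)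

  cycAdj? : ∀ k → Decidable₂ (CycAdj G k)
  cycAdj? k i j = (suc (toℕ i) ℕ.≟ toℕ j) ⊎-dec (suc (toℕ j) ℕ.≟ toℕ i)
    ⊎-dec ((toℕ i ℕ.≟ 0) ×-dec (suc (toℕ j) ℕ.≟ k)) ⊎-dec ((toℕ j ℕ.≟ 0) ×-dec (suc (toℕ i) ℕ.≟ k))

  cycAdj-sym : ∀ {k i j} → CycAdj G k i j → CycAdj G k j i
  cycAdj-sym (inj₁ i+1≡j)                 = inj₂ (inj₁ i+1≡j)
  cycAdj-sym (inj₂ (inj₁ j+1≡i))          = inj₁ j+1≡i
  cycAdj-sym (inj₂ (inj₂ (inj₁ wrap)))    = inj₂ (inj₂ (inj₂ wrap))
  cycAdj-sym (inj₂ (inj₂ (inj₂ wrap)))    = inj₂ (inj₂ (inj₁ wrap))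

  module _ {k : ℕ} {w : ℕ → Fin n} (walk : ClosedWalk k w) where
    open ClosedWalk walk

    private
      f : Fin k → Fin n
      f i = w (toℕ i)

    w[k]≡w[0] : w k ≡ w 0
    w[k]≡w[0] = trans (cong w (sym (+-identityʳ k))) (period 0)

    cycAdj⇒~ : ∀ {i j} → CycAdj G k i j → f i ~ f j
    cycAdj⇒~ {i} (inj₁ i+1≡j) = subst (λ a → f i ~ w a) i+1≡j (edge (toℕ i))
    cycAdj⇒~ {j = j} (inj₂ (inj₁ j+1≡i)) = ~-sym (subst (λ a → f j ~ w a) j+1≡i (edge (toℕ j)))
    cycAdj⇒~ {i} {j} (inj₂ (inj₂ (inj₁ (i≡0 , j+1≡k)))) =
      ~-sym (subst (f j ~_) (trans (cong w j+1≡k) (trans w[k]≡w[0] (cong w (sym i≡0)))) (edge (toℕ j)))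
    cycAdj⇒~ {i} {j} (inj₂ (inj₂ (inj₂ (j≡0 , i+1≡k)))) =
      subst (f i ~_) (trans (cong w i+1≡k) (trans w[k]≡w[0] (cong w (sym j≡0)))) (edge (toℕ i))

    module _ (chordless : Chordless k w) where

      -- A chord of offset d > k/2 is a chord of offset k − d seen from its other end.
      chord≁ : ∀ r d → 2 ≤ d → 2 + d ≤ k → w r ≁ w (d + r)
      chord≁ r d 2≤d 2+d≤k with d + d ≤? k
      ... | yes d+d≤k = chordless r d 2≤d d+d≤k
      ... | no d+d≰k  = ≁-sym (subst (w (d + r) ≁_) wrap (chordless (d + r) e 2≤e e+e≤k))
        where
        e : ℕ
        e = k ∸ d
        e+d≡k : e + d ≡ k
        e+d≡k = m∸n+n≡m (≤-trans (m≤n+m d 2) 2+d≤k)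
        wrap : w (e + (d + r)) ≡ w r
        wrap = trans (cong w (trans (sym (+-assoc e d r)) (cong (_+ r) e+d≡k))) (period r)
        2≤e : 2 ≤ e
        2≤e = +-cancelʳ-≤ d 2 e (subst (2 + d ≤_) (sym e+d≡k) 2+d≤k)
        e<d : e < d
        e<d = +-cancelʳ-< d e d (subst (_< d + d) (sym e+d≡k) (≰⇒> d+d≰k))
        e+e≤k : e + e ≤ k
        e+e≤k = subst (e + e ≤_) e+d≡k (+-monoʳ-≤ e (<⇒≤ e<d))

      <⇒≁ : ∀ {i j} → toℕ i < toℕ j → ¬ CycAdj G k i j → f i ≁ f j
      <⇒≁ {i} {j} i<j ¬i~j with toℕ j ∸ toℕ i | m∸n+n≡m (<⇒≤ i<j)
      ... | zero            | i≡j   = contradiction (subst (toℕ i <_) (sym i≡j) i<j) (<-irrefl refl)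
      ... | suc zero        | i+1≡j = contradiction (inj₁ i+1≡j) ¬i~j
      ... | suc (suc d)     | d+i≡j =
        subst (λ b → f i ≁ w b) d+i≡j
              (chord≁ (toℕ i) (2 + d) (s≤s (s≤s z≤n)) (room (toℕ i) d+i<k notWrap))
        where
        d+i<k : 2 + d + toℕ i < k
        d+i<k = subst (_< k) (sym d+i≡j) (toℕ<n j)
        notWrap : toℕ i ≡ 0 → suc (2 + d + toℕ i) ≢ k
        notWrap i≡0 wraps = ¬i~j (inj₂ (inj₂ (inj₁ (i≡0 , trans (cong suc (sym d+i≡j)) wraps))))
        room : ∀ {c} a → c + a < k → (a ≡ 0 → suc (c + a) ≢ k) → 2 + c ≤ k
        room {c} zero    c+0<k notWrap =
          subst (λ b → 2 + b ≤ k) (+-identityʳ c) (≤∧≢⇒< c+0<k (notWrap refl))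
        room {c} (suc a) c+a<k _       =
          ≤-trans (s≤s (subst (suc c ≤_) (sym (+-suc c a)) (s≤s (m≤m+n c a)))) c+a<k

      ≢⇒≁ : ∀ {i j} → i ≢ j → ¬ CycAdj G k i j → f i ≁ f j
      ≢⇒≁ {i} {j} i≢j ¬i~j with <-cmp (toℕ i) (toℕ j)
      ... | tri< i<j _ _ = <⇒≁ i<j ¬i~j
      ... | tri≈ _ i≡j _ = contradiction (toℕ-injective i≡j) i≢j
      ... | tri> _ _ j<i = ≁-sym (<⇒≁ j<i (¬i~j ∘ cycAdj-sym))

      closedWalk⇒inducedCycle : HasInducedCycle G k
      closedWalk⇒inducedCycle = f , injective , λ i j → mk⇔ (~⇒cycAdj i j) cycAdj⇒~
        where
        injective : ∀ {i j} → f i ≡ f j → i ≡ j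
        injective {i} {j} fi≡fj with i ≟ᶠ j | cycAdj? k i j
        ... | yes i≡j | _        = i≡j
        ... | no _    | yes i~j  = contradiction fi≡fj (~⇒≢ (cycAdj⇒~ i~j))
        ... | no i≢j  | no ¬i~j  = contradiction fi≡fj (proj₁ (≢⇒≁ i≢j ¬i~j))
        ~⇒cycAdj : ∀ i j → f i ~ f j → CycAdj G k i j
        ~⇒cycAdj i j fi~fj with i ≟ᶠ j | cycAdj? k i j
        ... | _       | yes i~j = i~j
        ... | yes refl | no _   = contradiction fi~fj ~-irrefl
        ... | no i≢j  | no ¬i~j = contradiction fi~fj (proj₂ (≢⇒≁ i≢j ¬i~j))

  -- Rotating the arguments at each step makes walkₖ k-periodic by definition.
  walk₃ : Fin n → Fin n → Fin n → ℕ → Fin n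
  walk₃ a₀ a₁ a₂ zero    = a₀
  walk₃ a₀ a₁ a₂ (suc i) = walk₃ a₁ a₂ a₀ i

  walk₃-closed : ∀ {a₀ a₁ a₂} → a₀ ~ a₁ → a₁ ~ a₂ → a₂ ~ a₀ → ClosedWalk 3 (walk₃ a₀ a₁ a₂)
  walk₃-closed e₀ e₁ e₂ = record { edge = edges e₀ e₁ e₂ ; period = λ _ → refl }
    where
    edges : ∀ {a₀ a₁ a₂} → a₀ ~ a₁ → a₁ ~ a₂ → a₂ ~ a₀ →
            ∀ i → walk₃ a₀ a₁ a₂ i ~ walk₃ a₀ a₁ a₂ (suc i)
    edges e₀ e₁ e₂ zero    = e₀
    edges e₀ e₁ e₂ (suc i) = edges e₁ e₂ e₀ i

  walk₄ : Fin n → Fin n → Fin n → Fin n → ℕ → Fin n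
  walk₄ a₀ a₁ a₂ a₃ zero    = a₀
  walk₄ a₀ a₁ a₂ a₃ (suc i) = walk₄ a₁ a₂ a₃ a₀ i

  walk₄-closed : ∀ {a₀ a₁ a₂ a₃} → a₀ ~ a₁ → a₁ ~ a₂ → a₂ ~ a₃ → a₃ ~ a₀ →
                 ClosedWalk 4 (walk₄ a₀ a₁ a₂ a₃)
  walk₄-closed e₀ e₁ e₂ e₃ = record { edge = edges e₀ e₁ e₂ e₃ ; period = λ _ → refl }
    where
    edges : ∀ {a₀ a₁ a₂ a₃} → a₀ ~ a₁ → a₁ ~ a₂ → a₂ ~ a₃ → a₃ ~ a₀ →
            ∀ i → walk₄ a₀ a₁ a₂ a₃ i ~ walk₄ a₀ a₁ a₂ a₃ (suc i)
    edges e₀ e₁ e₂ e₃ zero    = e₀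
    edges e₀ e₁ e₂ e₃ (suc i) = edges e₁ e₂ e₃ e₀ i

  walk₅ : Fin n → Fin n → Fin n → Fin n → Fin n → ℕ → Fin n
  walk₅ a₀ a₁ a₂ a₃ a₄ zero    = a₀
  walk₅ a₀ a₁ a₂ a₃ a₄ (suc i) = walk₅ a₁ a₂ a₃ a₄ a₀ i

  walk₅-closed : ∀ {a₀ a₁ a₂ a₃ a₄} → a₀ ~ a₁ → a₁ ~ a₂ → a₂ ~ a₃ → a₃ ~ a₄ → a₄ ~ a₀ →
                 ClosedWalk 5 (walk₅ a₀ a₁ a₂ a₃ a₄)
  walk₅-closed e₀ e₁ e₂ e₃ e₄ = record { edge = edges e₀ e₁ e₂ e₃ e₄ ; period = λ _ → refl }
    where
    edges : ∀ {a₀ a₁ a₂ a₃ a₄} → a₀ ~ a₁ → a₁ ~ a₂ → a₂ ~ a₃ → a₃ ~ a₄ → a₄ ~ a₀ →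
            ∀ i → walk₅ a₀ a₁ a₂ a₃ a₄ i ~ walk₅ a₀ a₁ a₂ a₃ a₄ (suc i)
    edges e₀ e₁ e₂ e₃ e₄ zero    = e₀
    edges e₀ e₁ e₂ e₃ e₄ (suc i) = edges e₁ e₂ e₃ e₄ e₀ i

  walk₇ : Fin n → Fin n → Fin n → Fin n → Fin n → Fin n → Fin n → ℕ → Fin n
  walk₇ a₀ a₁ a₂ a₃ a₄ a₅ a₆ zero    = a₀
  walk₇ a₀ a₁ a₂ a₃ a₄ a₅ a₆ (suc i) = walk₇ a₁ a₂ a₃ a₄ a₅ a₆ a₀ i

  walk₇-closed : ∀ {a₀ a₁ a₂ a₃ a₄ a₅ a₆} →
                 a₀ ~ a₁ → a₁ ~ a₂ → a₂ ~ a₃ → a₃ ~ a₄ → a₄ ~ a₅ → a₅ ~ a₆ → a₆ ~ a₀ →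
                 ClosedWalk 7 (walk₇ a₀ a₁ a₂ a₃ a₄ a₅ a₆)
  walk₇-closed e₀ e₁ e₂ e₃ e₄ e₅ e₆ = record { edge = edges e₀ e₁ e₂ e₃ e₄ e₅ e₆ ; period = λ _ → refl }
    where
    edges : ∀ {a₀ a₁ a₂ a₃ a₄ a₅ a₆} →
            a₀ ~ a₁ → a₁ ~ a₂ → a₂ ~ a₃ → a₃ ~ a₄ → a₄ ~ a₅ → a₅ ~ a₆ → a₆ ~ a₀ →
            ∀ i → walk₇ a₀ a₁ a₂ a₃ a₄ a₅ a₆ i ~ walk₇ a₀ a₁ a₂ a₃ a₄ a₅ a₆ (suc i)
    edges e₀ e₁ e₂ e₃ e₄ e₅ e₆ zero    = e₀
    edges e₀ e₁ e₂ e₃ e₄ e₅ e₆ (suc i) = edges e₁ e₂ e₃ e₄ e₅ e₆ e₀ i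

  noTriangle : ¬ HasInducedCycle G 3 → ∀ {a₀ a₁ a₂} → a₀ ~ a₁ → a₁ ~ a₂ → a₂ ~ a₀ → Empty.⊥
  noTriangle noC₃ {a₀} {a₁} {a₂} e₀ e₁ e₂ =
    noC₃ (closedWalk⇒inducedCycle (walk₃-closed e₀ e₁ e₂) chordless)
    where
    chordless : Chordless 3 (walk₃ a₀ a₁ a₂)
    chordless _ _ 2≤d d+d≤3 = contradiction (≤-trans (+-mono-≤ 2≤d 2≤d) d+d≤3) 1+n≰n

  noShortcut : ¬ HasInducedCycle G 3 → ∀ {k w} → ClosedWalk k w → ∀ r → ¬ w r ~ w (2 + r)
  noShortcut noC₃ walk r shortcut = noTriangle noC₃ (edge r) (edge (1 + r)) (~-sym shortcut)
    where open ClosedWalk walk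

  noSquare : ¬ HasInducedCycle G 3 → ¬ HasInducedCycle G 4 →
             ∀ {a₀ a₁ a₂ a₃} → a₀ ~ a₁ → a₁ ~ a₂ → a₂ ~ a₃ → a₃ ~ a₀ → a₀ ≢ a₂ → a₁ ≢ a₃ → Empty.⊥
  noSquare noC₃ noC₄ {a₀} {a₁} {a₂} {a₃} e₀ e₁ e₂ e₃ a₀≢a₂ a₁≢a₃ =
    noC₄ (closedWalk⇒inducedCycle walk chordless)
    where
    walk : ClosedWalk 4 (walk₄ a₀ a₁ a₂ a₃)
    walk = walk₄-closed e₀ e₁ e₂ e₃
    diagonals : ∀ {b₀ b₁ b₂ b₃} → b₀ ≢ b₂ → b₁ ≢ b₃ →
                ∀ r → walk₄ b₀ b₁ b₂ b₃ r ≢ walk₄ b₀ b₁ b₂ b₃ (2 + r)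
    diagonals b₀≢b₂ b₁≢b₃ zero    = b₀≢b₂
    diagonals b₀≢b₂ b₁≢b₃ (suc r) = diagonals b₁≢b₃ (≢-sym b₀≢b₂) r
    chordless : Chordless 4 (walk₄ a₀ a₁ a₂ a₃)
    chordless r 1 (s≤s ()) _
    chordless r 2 _ _ = diagonals a₀≢a₂ a₁≢a₃ r , noShortcut noC₃ walk r
    chordless r (suc (suc (suc d))) 2≤d d+d≤4 =
      contradiction (≤-trans (+-mono-≤ (m≤m+n 3 d) 2≤d) d+d≤4) 1+n≰n

  -- Identifying or joining two vertices of an odd closed walk splits it into shorter odd closed walks.
  noClosedWalk₅ : ¬ HasInducedCycle G 3 → ¬ HasInducedCycle G 5 →
                  ∀ {a₀ a₁ a₂ a₃ a₄} → a₀ ~ a₁ → a₁ ~ a₂ → a₂ ~ a₃ → a₃ ~ a₄ → a₄ ~ a₀ → Empty.⊥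
  noClosedWalk₅ noC₃ noC₅ {a₀} {a₁} {a₂} {a₃} {a₄} e₀ e₁ e₂ e₃ e₄ =
    noC₅ (closedWalk⇒inducedCycle walk chordless)
    where
    w : ℕ → Fin n
    w = walk₅ a₀ a₁ a₂ a₃ a₄
    walk : ClosedWalk 5 w
    walk = walk₅-closed e₀ e₁ e₂ e₃ e₄
    open ClosedWalk walk
    chordless : Chordless 5 w
    chordless r 1 (s≤s ()) _
    chordless r 2 _ _ =
      (λ w[r]≡w[2+r] → noTriangle noC₃ (edge (2 + r)) (edge (3 + r))
                         (subst (w (4 + r) ~_) (trans (period r) w[r]≡w[2+r]) (edge (4 + r))))
      , noShortcut noC₃ walk r
    chordless r (suc (suc (suc d))) _ d+d≤5 =
      contradiction (≤-trans (+-mono-≤ (m≤m+n 3 d) (m≤m+n 3 d)) d+d≤5) 1+n≰n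

  noClosedWalk₇ : ¬ HasInducedCycle G 3 → ¬ HasInducedCycle G 5 → ¬ HasInducedCycle G 7 →
                  ∀ {a₀ a₁ a₂ a₃ a₄ a₅ a₆} →
                  a₀ ~ a₁ → a₁ ~ a₂ → a₂ ~ a₃ → a₃ ~ a₄ → a₄ ~ a₅ → a₅ ~ a₆ → a₆ ~ a₀ → Empty.⊥
  noClosedWalk₇ noC₃ noC₅ noC₇ {a₀} {a₁} {a₂} {a₃} {a₄} {a₅} {a₆} e₀ e₁ e₂ e₃ e₄ e₅ e₆ =
    noC₇ (closedWalk⇒inducedCycle walk chordless)
    where
    w : ℕ → Fin n
    w = walk₇ a₀ a₁ a₂ a₃ a₄ a₅ a₆
    walk : ClosedWalk 7 w
    walk = walk₇-closed e₀ e₁ e₂ e₃ e₄ e₅ e₆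
    open ClosedWalk walk
    chordless : Chordless 7 w
    chordless r 1 (s≤s ()) _
    chordless r 2 _ _ =
      (λ w[r]≡w[2+r] → noClosedWalk₅ noC₃ noC₅ (edge (2 + r)) (edge (3 + r)) (edge (4 + r))
                         (edge (5 + r))
                         (subst (w (6 + r) ~_) (trans (period r) w[r]≡w[2+r]) (edge (6 + r))))
      , noShortcut noC₃ walk r
    chordless r 3 _ _ =
      (λ w[r]≡w[3+r] → noTriangle noC₃ (edge r) (edge (1 + r))
                         (subst (w (2 + r) ~_) (sym w[r]≡w[3+r]) (edge (2 + r))))
      , (λ w[r]~w[3+r] → noClosedWalk₅ noC₃ noC₅ w[r]~w[3+r] (edge (3 + r)) (edge (4 + r)) (edge (5 + r))
                           (subst (w (6 + r) ~_) (period r) (edge (6 + r))))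
    chordless r (suc (suc (suc (suc d)))) _ d+d≤7 =
      contradiction (≤-trans (+-mono-≤ (m≤m+n 4 d) (m≤m+n 4 d)) d+d≤7) 1+n≰n

  ¬InU-endpoint : ∀ {a b c} → a ~ b → b ~ c → a ≢ c → ¬ a ~ c → ¬ InU G a
  ¬InU-endpoint a~b b~c a≢c ¬a~c a∈U = ¬a~c (a∈U _ _ here (step (step here a~b) b~c) a≢c)

  hasExactly0⇒¬ : ∀ {P : Fin n → Set} → HasExactly G P 0 → ∀ v → ¬ P v
  hasExactly0⇒¬ ([] , _ , members , _) v p with Equivalence.from (members v) p
  ... | ()

  ¬Leaf⇒secondNeighbour : ∀ {y z} → ¬ Leaf G z → ¬ InU G z → ¬ InU G y → z ~ y →
                          ∃ λ w → z ~ w × w ≢ y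
  ¬Leaf⇒secondNeighbour {y} {z} ¬leaf z∉U y∉U z~y with any? (λ w → (z ~? w) ×-dec ¬? (w ≟ᶠ y))
  ... | yes found = found
  ... | no none   = contradiction (z∉U , (y ∷ [] , [] ∷ [] , onlyY , refl)) ¬leaf
    where
    onlyY : ∀ u → (u List.∈ y ∷ []) ⇔ (¬ InU G u × z ~ u)
    onlyY u = mk⇔ (λ { (Any.here refl) → y∉U , z~y })
                  (λ (_ , z~u) → Any.here (decidable-stable (u ≟ᶠ y) (λ u≢y → none (u , z~u , u≢y))))

  independent⁺ : ∀ {S} → (∀ {u v} → u ∈ S → v ∈ S → ¬ u ~ v) → Independent G S
  independent⁺ noEdge u v u∈S v∈S = ¬-not (noEdge u∈S v∈S)

  independent⁻ : ∀ {S u v} → Independent G S → u ∈ S → v ∈ S → ¬ u ~ v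
  independent⁻ {u = u} {v} ind u∈S v∈S u~v with trans (sym (ind u v u∈S v∈S)) u~v
  ... | ()

  ⊆-independent : ∀ {p q} → p ⊆ q → Independent G q → Independent G p
  ⊆-independent p⊆q ind u v u∈p v∈p = ind u v (p⊆q u∈p) (p⊆q v∈p)

  ⁅⁆-independent : ∀ v → Independent G ⁅ v ⁆
  ⁅⁆-independent v = independent⁺ λ u∈⁅v⁆ w∈⁅v⁆ →
    subst₂ (λ a b → ¬ a ~ b) (sym (x∈⁅y⁆⇒x≡y v u∈⁅v⁆)) (sym (x∈⁅y⁆⇒x≡y v w∈⁅v⁆)) ~-irrefl

  ∪-independent : ∀ {p q} → Independent G p → Independent G q → (∀ {u v} → u ∈ p → v ∈ q → ¬ u ~ v) →
                  Independent G (p ∪ q)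
  ∪-independent {p} {q} indP indQ noCross =
    independent⁺ λ u∈p∪q v∈p∪q → edgeFree (x∈p∪q⁻ p q u∈p∪q) (x∈p∪q⁻ p q v∈p∪q)
    where
    edgeFree : ∀ {u v} → u ∈ p ⊎ u ∈ q → v ∈ p ⊎ v ∈ q → ¬ u ~ v
    edgeFree (inj₁ u∈p) (inj₁ v∈p) = independent⁻ indP u∈p v∈p
    edgeFree (inj₁ u∈p) (inj₂ v∈q) = noCross u∈p v∈q
    edgeFree (inj₂ u∈q) (inj₁ v∈p) = noCross v∈p u∈q ∘ ~-sym
    edgeFree (inj₂ u∈q) (inj₂ v∈q) = independent⁻ indQ u∈q v∈q

  Dominates : Subset n → Fin n → Set
  Dominates S v = ∃ λ u → u ∈ S × u ~ v

  extendAlong : ∀ {S} → Independent G S → (vs : List (Fin n)) →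
                ∃ λ S′ → Independent G S′ × S ⊆ S′ × (∀ {v} → v List.∈ vs → v ∈ S′ ⊎ Dominates S′ v)
  extendAlong {S} indS [] = S , indS , id , λ ()
  extendAlong {S} indS (v ∷ vs) with any? (λ u → (u ∈? S) ×-dec (u ~? v))
  ... | yes (u , u∈S , u~v) =
    let S′ , indS′ , S⊆S′ , covers = extendAlong indS vs
    in  S′ , indS′ , S⊆S′
      , λ { (Any.here refl) → inj₂ (u , S⊆S′ u∈S , u~v) ; (Any.there v∈vs) → covers v∈vs }
  ... | no undominated =
    let S′ , indS′ , S∪v⊆S′ , covers = extendAlong (∪-independent indS (⁅⁆-independent v) noCross) vs
    in  S′ , indS′ , S∪v⊆S′ ∘ p⊆p∪q ⁅ v ⁆
      , λ { (Any.here refl) → inj₁ (S∪v⊆S′ (x∈p∪q⁺ (inj₂ (x∈⁅x⁆ v)))) ; (Any.there v∈vs) → covers v∈vs }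
    where
    noCross : ∀ {u w} → u ∈ S → w ∈ ⁅ v ⁆ → ¬ u ~ w
    noCross {u} u∈S w∈⁅v⁆ u~w = undominated (u , u∈S , subst (u ~_) (x∈⁅y⁆⇒x≡y v w∈⁅v⁆) u~w)

  maximalExtension : ∀ {T} → Independent G T → ∃ λ S → MaximalIndependent G S × T ⊆ S
  maximalExtension indT =
    let S , indS , T⊆S , covers = extendAlong indT (allFin n)
    in  S , (indS , λ v v∉S → [ flip contradiction v∉S , id ]′ (covers (∈-allFin v))) , T⊆S

  independent≤suc-maximal : AlmostWellCovered G → ∀ {I S} → Independent G I → MaximalIndependent G S →
                            ∣ I ∣ ≤ suc ∣ S ∣
  independent≤suc-maximal (_ , _ , (_ , α-max) , (_ , i-min) , refl) {I} {S} indI maxS =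
    ≤-trans (α-max I indI) (s≤s (i-min S maxS))

  module Type0Neighbourhood
    (noC₃ : ¬ HasInducedCycle G 3) (noC₄ : ¬ HasInducedCycle G 4)
    (noC₅ : ¬ HasInducedCycle G 5) (noC₇ : ¬ HasInducedCycle G 7)
    (x : Fin n) (Y : Subset n) (Y⊆N₀ : ∀ {y} → y ∈ Y → x ~ y × Type0 G y)
    where

    Beyond : Fin n → Set
    Beyond w = ∃ λ y → y ∈ Y × ∃ λ z → y ~ z × z ≢ x × z ~ w × w ≢ y

    beyond? : Decidable Beyond
    beyond? w = any? λ y → (y ∈? Y) ×-dec any? λ z →
      (y ~? z) ×-dec ¬? (z ≟ᶠ x) ×-dec (z ~? w) ×-dec ¬? (w ≟ᶠ y)

    x≁beyond : ∀ {w} → Beyond w → ¬ x ~ w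
    x≁beyond (y , y∈Y , z , y~z , z≢x , z~w , w≢y) x~w =
      noSquare noC₃ noC₄ (proj₁ (Y⊆N₀ y∈Y)) y~z z~w (~-sym x~w) (≢-sym z≢x) (≢-sym w≢y)

    beyond≁beyond : ∀ {w w′} → Beyond w → Beyond w′ → ¬ w ~ w′
    beyond≁beyond (y , y∈Y , z , y~z , _ , z~w , _) (y′ , y′∈Y , z′ , y′~z′ , _ , z′~w′ , _) w~w′ =
      noClosedWalk₇ noC₃ noC₅ noC₇ (proj₁ (Y⊆N₀ y∈Y)) y~z z~w w~w′
                    (~-sym z′~w′) (~-sym y′~z′) (~-sym (proj₁ (Y⊆N₀ y′∈Y)))

    T : Subset n
    T = ⁅ x ⁆ ∪ toSubset beyond?

    T-independent : Independent G T
    T-independent = ∪-independent (⁅⁆-independent x) beyond-independent x≁T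
      where
      beyond-independent : Independent G (toSubset beyond?)
      beyond-independent = independent⁺ λ u∈ v∈ →
        beyond≁beyond (∈-toSubset⁻ beyond? u∈) (∈-toSubset⁻ beyond? v∈)
      x≁T : ∀ {u v} → u ∈ ⁅ x ⁆ → v ∈ toSubset beyond? → ¬ u ~ v
      x≁T u∈⁅x⁆ v∈ rewrite x∈⁅y⁆⇒x≡y x u∈⁅x⁆ = x≁beyond (∈-toSubset⁻ beyond? v∈)

    S : Subset n
    S = proj₁ (maximalExtension T-independent)

    S-maximal : MaximalIndependent G S
    S-maximal = proj₁ (proj₂ (maximalExtension T-independent))

    T⊆S : T ⊆ S
    T⊆S = proj₂ (proj₂ (maximalExtension T-independent))

    x∈S : x ∈ S
    x∈S = T⊆S (x∈p∪q⁺ (inj₁ (x∈⁅x⁆ x)))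

    S-independent : Independent G S
    S-independent = proj₁ S-maximal

    S∩Y≡∅ : ∀ {v} → v ∈ S → v ∉ Y
    S∩Y≡∅ v∈S v∈Y = independent⁻ S-independent x∈S v∈S (proj₁ (Y⊆N₀ v∈Y))

    S-x≁Y : ∀ {s y} → s ∈ S - x → y ∈ Y → ¬ s ~ y
    S-x≁Y {s} {y} s∈S-x y∈Y s~y = separated (Y⊆N₀ y∈Y)
      where
      s∈S : s ∈ S
      s∈S = p─q⊆p S ⁅ x ⁆ s∈S-x
      s≢x : s ≢ x
      s≢x = x∈p-y⇒x≢y s∈S-x
      ¬s~x : ¬ s ~ x
      ¬s~x = independent⁻ S-independent s∈S x∈S
      separated : x ~ y × Type0 G y → Empty.⊥
      separated (x~y , inj₁ y∈U) = ¬s~x (y∈U s x (step here (~-sym s~y)) (step here (~-sym x~y)) s≢x)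
      separated (x~y , inj₂ ((y∉U , _) , noLeafNeighbours)) =
        let s∉U   = ¬InU-endpoint s~y (~-sym x~y) s≢x ¬s~x
            ¬leaf = λ leaf → hasExactly0⇒¬ noLeafNeighbours s (~-sym s~y , leaf)
            w , s~w , w≢y = ¬Leaf⇒secondNeighbour ¬leaf s∉U y∉U s~y
            w∈S = T⊆S (x∈p∪q⁺ (inj₂ (∈-toSubset⁺ beyond? (y , y∈Y , s , ~-sym s~y , s≢x , s~w , w≢y))))
        in  independent⁻ S-independent s∈S w∈S s~w

    S-x∪Y-independent : Independent G ((S - x) ∪ Y)
    S-x∪Y-independent = ∪-independent (⊆-independent (p─q⊆p S ⁅ x ⁆) S-independent) Y-independent S-x≁Y
      where
      Y-independent : Independent G Y
      Y-independent = independent⁺ λ y∈Y y′∈Y y~y′ →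
        noTriangle noC₃ (proj₁ (Y⊆N₀ y∈Y)) y~y′ (~-sym (proj₁ (Y⊆N₀ y′∈Y)))

    ∣Y∣≤2 : AlmostWellCovered G → ∣ Y ∣ ≤ 2
    ∣Y∣≤2 awc = +-cancelˡ-≤ ∣ S - x ∣ ∣ Y ∣ 2 (begin
      ∣ S - x ∣ + ∣ Y ∣  ≡⟨ ∣p∪q∣≡∣p∣+∣q∣ (S - x) Y (S∩Y≡∅ ∘ p─q⊆p S ⁅ x ⁆) ⟨
      ∣ (S - x) ∪ Y ∣    ≤⟨ independent≤suc-maximal awc S-x∪Y-independent S-maximal ⟩
      suc ∣ S ∣          ≡⟨ cong suc (suc∣p-x∣≡∣p∣ S x∈S) ⟨
      2 + ∣ S - x ∣      ≡⟨ +-comm 2 ∣ S - x ∣ ⟩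
      ∣ S - x ∣ + 2      ∎)
      where open ≤-Reasoning

-- Only the neighbours of x need type 0.
lemma3p8 : (G : Graph) → AlmostWellCovered G → ¬ HasInducedCycle G 3 → ¬ HasInducedCycle G 4 → ¬ HasInducedCycle G 5 → ¬ HasInducedCycle G 7 →
    (x : Fin (Graph.n G)) → Type0 G x → DegG0AtMost G x 2
lemma3p8 G awc noC₃ noC₄ noC₅ noC₇ x _ xs unique N₀ =
  subst (_≤ 2) (∣fromList∣≡length xs unique)
    (Type0Neighbourhood.∣Y∣≤2 G noC₃ noC₄ noC₅ noC₇ x (fromList xs) (N₀ _ ∘ ∈-fromList⁻ xs) awc)
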